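{- For any word $x$, $q(x)\le t(x)+1$.
   Context: A word $w$ is a minimal absent word of $x$ if $w$ is not a factor of $x$ but every proper factor of $w$ is a factor of $x$. A $q$-gram of a word is a factor of length $q$. $q(x)$ is the largest integer $q$ such that every $q$-gram of $x$ is a $q$-gram of some minimal absent word of $x$. An infix of $x$ is a factor that is neither a prefix nor a suffix of $x$. $t(x)$ is the length of a shortest infix of $x$ that occurs exactly once in $x$. -}

module Defs where

open import Data.Nat using (ℕ; _≤_; _<_)
open import Data.List using (List; _++_; length)
open import Data.Product using (Σ; ∃; ∃-syntax; _×_)
open import Relation.Binary.PropositionalEquality using (_≡_; _≢_)
open import Relation.Nullary using (¬_)

module _ {A : Set} where

  Factor : List A → List A → Set
  Factor u x = ∃[ p ] ∃[ s ] (p ++ u ++ s ≡ x)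

  Prefix : List A → List A → Set
  Prefix u x = ∃[ s ] (u ++ s ≡ x)

  Suffix : List A → List A → Set
  Suffix u x = ∃[ p ] (p ++ u ≡ x)

  ProperFactor : List A → List A → Set
  ProperFactor u w = Factor u w × u ≢ w

  MinimalAbsent : List A → List A → Set
  MinimalAbsent w x = ¬ Factor w x × (∀ u → ProperFactor u w → Factor u x)

  Gram : ℕ → List A → List A → Set
  Gram q u w = Factor u w × length u ≡ q

  GramsCovered : List A → ℕ → Set
  GramsCovered x q = ∀ u → Gram q u x → ∃[ w ] (MinimalAbsent w x × Gram q u w)

  -- q is q(x): the largest q (among q with x having q-grams, i.e. q ≤ |x|)
  -- such that every q-gram of x is a q-gram of some minimal absent word of x
  IsQ : List A → ℕ → Set
  IsQ x q = (q ≤ length x × GramsCovered x q)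
          × (∀ q' → q' ≤ length x → GramsCovered x q' → q' ≤ q)

  OccursAt : List A → List A → ℕ → Set
  OccursAt u x i = ∃[ p ] ∃[ s ] (p ++ u ++ s ≡ x × length p ≡ i)

  OccursOnce : List A → List A → Set
  OccursOnce u x = ∃[ i ] (OccursAt u x i × (∀ j → OccursAt u x j → j ≡ i))

  Infix : List A → List A → Set
  Infix u x = Factor u x × ¬ Prefix u x × ¬ Suffix u x

  UniqueInfix : List A → List A → Set
  UniqueInfix u x = Infix u x × OccursOnce u x

  IsT : List A → ℕ → Set
  IsT x t = (∃[ u ] (UniqueInfix u x × length u ≡ t))
          × (∀ u → UniqueInfix u x → t ≤ length u)

module Submission where

-- Let u be a shortest infix of x occurring exactly once, say
-- x = p u s with p and s nonempty, and suppose q ≥ |u| + 2.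
--   (1) Because u occurs only once, a word L u R is a factor of x exactly
--       when L is a suffix of p and R is a prefix of s.
--   (2) Hence no minimal absent word w of x can contain u with at least one
--       letter on each side: writing w = (c L') u (R' d), the proper factors
--       L' u R' d and c L' u R' are factors of x, so by (1) c L' is a suffix
--       of p and R' d a prefix of s, and then w itself is a factor of x.
--   (3) Since |u| + 2 ≤ q ≤ |x| and p, s are nonempty, x has a q-gram
--       v = p₂ u s₁ with p₂, s₁ nonempty.  By the definition of q, v is a
--       q-gram of some minimal absent word, contradicting (2).

open import Defs
open import Data.Nat using (ℕ; zero; suc; pred; _≤_; _+_; _∸_; s≤s; z≤n; _≤?_)
open import Data.Nat.Properties
  using (≰⇒>; m≤n⇒∃[o]m+o≡n; +-cancelˡ-≤; m∸[m∸n]≡n; m≤n⇒m⊓n≡m; ≤-trans; ≤-reflexive)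
open import Data.Nat.Tactic.RingSolver using (solve-∀)
open import Data.List using (List; []; _∷_; _++_; [_]; length; head; take; drop; _∷ʳ_; initLast; _∷ʳ′_)
open import Data.List.Properties
  using (∷-injectiveʳ; ++-assoc; ++-cancelˡ; ++-identityʳ; ++-identityˡ-unique; ++-identityʳ-unique; ++-conicalˡ; ++-conicalʳ;
         length-++; length-take; length-drop; take++drop≡id)
open import Data.Product using (∃-syntax; _×_; _,_; proj₁; proj₂)
open import Data.Empty using (⊥-elim)
open import Relation.Nullary using (¬_; yes; no)
open import Relation.Binary.PropositionalEquality
  using (_≡_; _≢_; refl; sym; trans; cong; cong₂; subst; module ≡-Reasoning)

window-length : ∀ a b n → suc a + (n + suc b) ≡ suc (suc n) + (a + b)
window-length = solve-∀

split-budget : ∀ P S k → k ≤ P + S → ∃[ a ] ∃[ b ] (a ≤ P × b ≤ S × a + b ≡ k)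
split-budget zero    S k       k≤S      = 0 , k , z≤n , k≤S , refl
split-budget (suc P) S zero    _        = 0 , 0 , z≤n , z≤n , refl
split-budget (suc P) S (suc k) (s≤s k≤) with split-budget P S k k≤
... | a , b , a≤P , b≤S , a+b≡k = suc a , b , s≤s a≤P , b≤S , cong suc a+b≡k

module _ {A : Set} where

  ++-split-at-length : (a b c d : List A) → a ++ b ≡ c ++ d → length a ≡ length c →
                       a ≡ c × b ≡ d
  ++-split-at-length []      b []      d eq _ = refl , eq
  ++-split-at-length (x ∷ a) b (y ∷ c) d eq len
    with refl ← cong head eq
    with refl , refl ← ++-split-at-length a b c d (∷-injectiveʳ eq) (cong pred len)
       = refl , refl

  regroup : (P L u R S : List A) → P ++ (L ++ u ++ R) ++ S ≡ (P ++ L) ++ u ++ (R ++ S)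
  regroup P L u R S = begin
    P ++ (L ++ u ++ R) ++ S   ≡⟨ cong (P ++_) (++-assoc L (u ++ R) S) ⟩
    P ++ L ++ (u ++ R) ++ S   ≡⟨ cong (λ z → P ++ L ++ z) (++-assoc u R S) ⟩
    P ++ L ++ u ++ R ++ S     ≡⟨ ++-assoc P L (u ++ R ++ S) ⟨
    (P ++ L) ++ u ++ R ++ S   ∎
    where open ≡-Reasoning

  tail-proper : (c : A) (w : List A) → ProperFactor w (c ∷ w)
  tail-proper c w = ([ c ] , [] , cong (c ∷_) (++-identityʳ w)) , λ eq →
    [c]≢[] (++-identityˡ-unique [ c ] eq)
    where [c]≢[] : [ c ] ≢ []
          [c]≢[] ()

  init-proper : (w : List A) (d : A) → ProperFactor w (w ∷ʳ d)
  init-proper w d = ([] , [ d ] , refl) , λ eq → [d]≢[] (++-identityʳ-unique w eq)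
    where [d]≢[] : [ d ] ≢ []
          [d]≢[] ()

  ++-nonemptyʳ : (xs ys : List A) → ys ≢ [] → xs ++ ys ≢ []
  ++-nonemptyʳ xs ys ys≢[] eq = ys≢[] (++-conicalʳ xs ys eq)

  ++-nonemptyˡ : (xs ys : List A) → xs ≢ [] → xs ++ ys ≢ []
  ++-nonemptyˡ xs ys xs≢[] eq = xs≢[] (++-conicalˡ xs ys eq)

  suffix-of-length : (p : List A) (k : ℕ) → k ≤ length p →
                     ∃[ p₂ ] (Suffix p₂ p × length p₂ ≡ k)
  suffix-of-length p k k≤ =
    drop n p , (take n p , take++drop≡id n p) ,
    trans (length-drop n p) (m∸[m∸n]≡n k≤)
    where n = length p ∸ k

  prefix-of-length : (s : List A) (k : ℕ) → k ≤ length s →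
                     ∃[ s₁ ] (Prefix s₁ s × length s₁ ≡ k)
  prefix-of-length s k k≤ =
    take k s , (drop k s , take++drop≡id k s) ,
    trans (length-take k s) (m≤n⇒m⊓n≡m k≤)

  length-suc⇒nonempty : (xs : List A) {n : ℕ} → length xs ≡ suc n → xs ≢ []
  length-suc⇒nonempty [] () refl

  UniqueContext : (u x p s : List A) → Set
  UniqueContext u x p s =
    p ++ u ++ s ≡ x × (∀ Y Z → Y ++ u ++ Z ≡ x → Y ≡ p × Z ≡ s)

  occursOnce⇒context : (u x : List A) → OccursOnce u x →
                       ∃[ p ] ∃[ s ] UniqueContext u x p s
  occursOnce⇒context u x (i , (p , s , pus≡x , |p|≡i) , only-i) =
    p , s , pus≡x , λ Y Z YuZ≡x →
      let |Y|≡|p| = trans (only-i (length Y) (Y , Z , YuZ≡x , refl)) (sym |p|≡i)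
          Y≡p , uZ≡us = ++-split-at-length Y (u ++ Z) p (u ++ s) (trans YuZ≡x (sym pus≡x)) |Y|≡|p|
      in Y≡p , ++-cancelˡ u Z s uZ≡us

  module _ {u x p s : List A} (ctx : UniqueContext u x p s) where

    context⇒factor : (L R : List A) → Suffix L p → Prefix R s → Factor (L ++ u ++ R) x
    context⇒factor L R (F , FL≡p) (G , RG≡s) = F , G , (begin
      F ++ (L ++ u ++ R) ++ G   ≡⟨ regroup F L u R G ⟩
      (F ++ L) ++ u ++ (R ++ G) ≡⟨ cong₂ (λ a b → a ++ u ++ b) FL≡p RG≡s ⟩
      p ++ u ++ s               ≡⟨ proj₁ ctx ⟩
      x                         ∎)
      where open ≡-Reasoning

    factor⇒context : (L R : List A) → Factor (L ++ u ++ R) x → Suffix L p × Prefix R s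
    factor⇒context L R (F , G , eq) =
      let FL≡p , RG≡s = proj₂ ctx (F ++ L) (R ++ G) (trans (sym (regroup F L u R G)) eq)
      in (F , FL≡p) , (G , RG≡s)

    maw-not-around : (L R : List A) → L ≢ [] → R ≢ [] → ¬ MinimalAbsent (L ++ u ++ R) x
    maw-not-around []       R L≢[] _ _ = L≢[] refl
    maw-not-around (c ∷ L') R _ R≢[] (absent , minimal) with initLast R
    ... | []        = R≢[] refl
    ... | R' ∷ʳ′ d  = absent (context⇒factor (c ∷ L') (R' ∷ʳ d) L-suffix R-prefix)
      where
        -- Dropping the last letter leaves a proper factor, so c L' is a suffix of p.
        shorter-right : (c ∷ L') ++ u ++ (R' ∷ʳ d) ≡ ((c ∷ L') ++ u ++ R') ∷ʳ d
        shorter-right = trans (cong ((c ∷ L') ++_) (sym (++-assoc u R' [ d ])))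
                              (sym (++-assoc (c ∷ L') (u ++ R') [ d ]))
        L-suffix : Suffix (c ∷ L') p
        L-suffix = proj₁ (factor⇒context (c ∷ L') R'
          (minimal _ (subst (ProperFactor _) (sym shorter-right) (init-proper _ d))))
        -- Dropping the first letter leaves a proper factor, so R' d is a prefix of s.
        R-prefix : Prefix (R' ∷ʳ d) s
        R-prefix = proj₂ (factor⇒context L' (R' ∷ʳ d)
          (minimal _ (tail-proper c _)))

    maw-no-factor-around : (L R w : List A) → L ≢ [] → R ≢ [] →
                           MinimalAbsent w x → ¬ Factor (L ++ u ++ R) w
    maw-no-factor-around L R w L≢[] R≢[] maw (α , β , eq) =
      maw-not-around (α ++ L) (R ++ β) (++-nonemptyʳ α L L≢[]) (++-nonemptyˡ R β R≢[])
        (subst (λ z → MinimalAbsent z x) (trans (sym eq) (regroup α L u R β)) maw)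

  window : (p u s : List A) → p ≢ [] → s ≢ [] → (k : ℕ) →
           suc (suc (length u)) ≤ k → k ≤ length (p ++ u ++ s) →
           ∃[ p₂ ] ∃[ s₁ ] (Suffix p₂ p × Prefix s₁ s × p₂ ≢ [] × s₁ ≢ [] ×
                            length (p₂ ++ u ++ s₁) ≡ k)
  window []       u s        p≢[] _    _ _ _ = ⊥-elim (p≢[] refl)
  window (_ ∷ _)  u []       _    s≢[] _ _ _ = ⊥-elim (s≢[] refl)
  window (c ∷ pp) u (e ∷ ss) _ _ k 2+|u|≤k k≤|x| =
    p₂ , s₁ , p₂-suffix , s₁-prefix ,
    length-suc⇒nonempty p₂ |p₂| , length-suc⇒nonempty s₁ |s₁| , |window|
    where
      open ≡-Reasoning
      m = proj₁ (m≤n⇒∃[o]m+o≡n 2+|u|≤k)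
      k≡ : suc (suc (length u)) + m ≡ k
      k≡ = proj₂ (m≤n⇒∃[o]m+o≡n 2+|u|≤k)
      |x| : length ((c ∷ pp) ++ u ++ (e ∷ ss)) ≡ suc (suc (length u)) + (length pp + length ss)
      |x| = begin
        length ((c ∷ pp) ++ u ++ (e ∷ ss))       ≡⟨ length-++ (c ∷ pp) ⟩
        suc (length pp) + length (u ++ e ∷ ss)   ≡⟨ cong (suc (length pp) +_) (length-++ u) ⟩
        suc (length pp) + (length u + suc (length ss))
                                                 ≡⟨ window-length (length pp) (length ss) (length u) ⟩
        suc (suc (length u)) + (length pp + length ss) ∎
      m≤ : m ≤ length pp + length ss
      m≤ = +-cancelˡ-≤ (suc (suc (length u))) m _
             (≤-trans (≤-reflexive k≡) (≤-trans k≤|x| (≤-reflexive |x|)))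
      shares = split-budget (length pp) (length ss) m m≤
      a = proj₁ shares
      b = proj₁ (proj₂ shares)
      a≤ = proj₁ (proj₂ (proj₂ shares))
      b≤ = proj₁ (proj₂ (proj₂ (proj₂ shares)))
      a+b≡m = proj₂ (proj₂ (proj₂ (proj₂ shares)))
      left = suffix-of-length (c ∷ pp) (suc a) (s≤s a≤)
      right = prefix-of-length (e ∷ ss) (suc b) (s≤s b≤)
      p₂ = proj₁ left
      p₂-suffix = proj₁ (proj₂ left)
      |p₂| = proj₂ (proj₂ left)
      s₁ = proj₁ right
      s₁-prefix = proj₁ (proj₂ right)
      |s₁| = proj₂ (proj₂ right)
      |window| : length (p₂ ++ u ++ s₁) ≡ k
      |window| = begin
        length (p₂ ++ u ++ s₁)                  ≡⟨ length-++ p₂ ⟩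
        length p₂ + length (u ++ s₁)            ≡⟨ cong (length p₂ +_) (length-++ u) ⟩
        length p₂ + (length u + length s₁)      ≡⟨ cong₂ (λ i j → i + (length u + j)) |p₂| |s₁| ⟩
        suc a + (length u + suc b)              ≡⟨ window-length a b (length u) ⟩
        suc (suc (length u)) + (a + b)          ≡⟨ cong (suc (suc (length u)) +_) a+b≡m ⟩
        suc (suc (length u)) + m                ≡⟨ k≡ ⟩
        k                                       ∎

lemma5 : {A : Set} (x : List A) (q t : ℕ) → IsQ x q → IsT x t → q ≤ suc t
lemma5 x q t ((q≤|x| , covered) , _) ((u , ((_ , not-prefix , not-suffix) , once) , |u|≡t) , _)
  with q ≤? suc t
... | yes q≤ = q≤
... | no q≰ =
  let p , s , ctx = occursOnce⇒context u x once
      pus≡x = proj₁ ctx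
      p≢[] : p ≢ []
      p≢[] = λ { refl → not-prefix (s , pus≡x) }
      s≢[] : s ≢ []
      s≢[] = λ { refl → not-suffix (p , trans (cong (p ++_) (sym (++-identityʳ u))) pus≡x) }
      2+|u|≤q = subst (λ n → suc (suc n) ≤ q) (sym |u|≡t) (≰⇒> q≰)
      q≤|pus| = subst (λ z → q ≤ length z) (sym pus≡x) q≤|x|
      p₂ , s₁ , p₂-suffix , s₁-prefix , p₂≢[] , s₁≢[] , |v|≡q = window p u s p≢[] s≢[] q 2+|u|≤q q≤|pus|
      v-gram = context⇒factor ctx p₂ s₁ p₂-suffix s₁-prefix , |v|≡q
      w , maw , v-in-w , _ = covered (p₂ ++ u ++ s₁) v-gram
  in ⊥-elim (maw-no-factor-around ctx p₂ s₁ w p₂≢[] s₁≢[] maw v-in-w)
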